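{- Let $t\ge1$, let $G$ be a graph with $\mu(G)\le t$, let $\varphi_1,\varphi_2$ be two optimal $\mathcal{SD}_t$-colorings of $G$, and let $H=H(\varphi_1,\varphi_2)$. Then: (a) if $X$ is the vertex set of a component of the hypergraph $H$, then $X$ is both $\varphi_1$-closed and $\varphi_2$-closed, and the coloring $\varphi_3=\varphi_1|_X\cup\varphi_2|_{\overline{X}}$ (whose non-empty color classes are the color classes of $\varphi_1$ contained in $X$ together with the color classes of $\varphi_2$ contained in $\overline{X}=V(G)\setminus X$) is an optimal $\mathcal{SD}_t$-coloring of $G$ with $I(\varphi_3)=(I(\varphi_1)\cap X)\cup(I(\varphi_2)\cap\overline{X})$; (b) if $v_1\in I(\varphi_1)$ and $v_2\in I(\varphi_2)$ are distinct vertices of $G$ with $\mu_G(v_1,v_2)\le t-1$, then $v_1$ and $v_2$ belong to the same component of $H$.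
   Context: All graphs are finite, undirected, loopless, and may have multiple edges; $\mu_G(u,v)$ is the number of edges joining $u,v$ and $\mu(G)=\max_{u\neq v}\mu_G(u,v)$. A graph is strictly $t$-degenerate if every non-empty subgraph $H$ has a vertex of degree (with multiplicity) at most $t-1$ in $H$. An $\mathcal{SD}_t$-coloring of $G$ is a map $\varphi:V(G)\to\Gamma$ such that each color class induces a strictly $t$-degenerate subgraph; $\chi_t(G)$ is the least number of colors in such a coloring; $\varphi$ is optimal if its number of non-empty color classes equals $\chi_t(G)$. $I(\varphi)$ is the set of vertices $v$ whose color class is $\{v\}$. $X$ is $\varphi$-closed if each non-empty color class of $\varphi$ is contained in $X$ or disjoint from $X$. $H(\varphi)$ is the hypergraph on $V(G)$ whose edges are the color classes of $\varphi$ of size at least 2, and $H(\varphi_1,\varphi_2)$ is the hypergraph on $V(G)$ whose edge set is $E(H(\varphi_1))\cup E(H(\varphi_2))$; components are taken with respect to this hypergraph. -}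

module Defs where

open import Data.Nat using (ℕ; _≤_; _<_; _∸_)
import Data.Nat as ℕ
open import Data.Fin using (Fin)
open import Data.Fin.Subset using (Subset; _∈_; _∉_; _⊆_; Nonempty)
open import Data.List using (List; length; map; allFin; deduplicate)
open import Data.Nat.ListAction using (sum)
open import Data.Product using (Σ; ∃; _×_; _,_)
open import Data.Sum using (_⊎_)
open import Relation.Binary.PropositionalEquality using (_≡_; _≢_)
open import Relation.Binary.Construct.Closure.ReflexiveTransitive using (Star)
open import Function.Bundles using (_⇔_)

-- A finite loopless multigraph on vertex set Fin n;
-- mult u v = μ_G(u,v), the number of edges joining u and v.
record Graph : Set where
  field
    n        : ℕ
    mult     : Fin n → Fin n → ℕ
    mult-sym : ∀ u v → mult u v ≡ mult v u
    loopless : ∀ v → mult v v ≡ 0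
open Graph public

Vertex : Graph → Set
Vertex G = Fin (n G)

MaxMultAtMost : (G : Graph) → ℕ → Set
MaxMultAtMost G t = ∀ (u v : Vertex G) → u ≢ v → mult G u v ≤ t

-- A (not necessarily induced) subgraph of G: a vertex set and an edge
-- multiplicity function bounded by that of G, supported on the vertex set.
record Subgraph (G : Graph) : Set where
  field
    vset    : Subset (n G)
    emult   : Vertex G → Vertex G → ℕ
    emult≤  : ∀ u v → emult u v ≤ mult G u v
    emult-sym : ∀ u v → emult u v ≡ emult v u
    emult-supp : ∀ u v → 0 < emult u v → (u ∈ vset) × (v ∈ vset)
open Subgraph public

degIn : {G : Graph} → Subgraph G → Vertex G → ℕ
degIn {G} H v = sum (map (emult H v) (allFin (n G)))

StrictlyDegenerateOn : (G : Graph) → ℕ → (Vertex G → Set) → Set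
StrictlyDegenerateOn G t A =
  ∀ (H : Subgraph G) → (∀ v → v ∈ vset H → A v) → Nonempty (vset H) →
  ∃ λ v → v ∈ vset H × degIn H v ≤ t ∸ 1

-- Colorings with colors in ℕ (any finite color set can be renamed into ℕ).
Coloring : Graph → Set
Coloring G = Vertex G → ℕ

IsSDColoring : (G : Graph) → ℕ → Coloring G → Set
IsSDColoring G t φ = ∀ (c : ℕ) → StrictlyDegenerateOn G t (λ v → φ v ≡ c)

numClasses : (G : Graph) → Coloring G → ℕ
numClasses G φ = length (deduplicate ℕ._≟_ (map φ (allFin (n G))))

IsChi : (G : Graph) → ℕ → ℕ → Set
IsChi G t k = (Σ (Coloring G) λ ψ → IsSDColoring G t ψ × numClasses G ψ ≡ k)
            × (∀ (ψ : Coloring G) → IsSDColoring G t ψ → k ≤ numClasses G ψ)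

IsOptimal : (G : Graph) → ℕ → Coloring G → Set
IsOptimal G t φ = IsSDColoring G t φ × IsChi G t (numClasses G φ)

InI : (G : Graph) → Coloring G → Vertex G → Set
InI G φ v = ∀ u → φ u ≡ φ v → u ≡ v

IsClosed : (G : Graph) → Coloring G → Subset (n G) → Set
IsClosed G φ X = ∀ (c : ℕ) → (∀ v → φ v ≡ c → v ∈ X) ⊎ (∀ v → φ v ≡ c → v ∉ X)

-- the color class of v under φ has size at least 2 (so it is an edge of H(φ))
BigClass : (G : Graph) → Coloring G → Vertex G → Set
BigClass G φ v = ∃ λ w → w ≢ v × φ w ≡ φ v

-- u and v lie in a common edge of H(φ1,φ2)
CoEdge : (G : Graph) → Coloring G → Coloring G → Vertex G → Vertex G → Set
CoEdge G φ₁ φ₂ u v = (φ₁ u ≡ φ₁ v × BigClass G φ₁ u) ⊎ (φ₂ u ≡ φ₂ v × BigClass G φ₂ u)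

Connected : (G : Graph) → Coloring G → Coloring G → Vertex G → Vertex G → Set
Connected G φ₁ φ₂ = Star (CoEdge G φ₁ φ₂)

IsComponent : (G : Graph) → Coloring G → Coloring G → Subset (n G) → Set
IsComponent G φ₁ φ₂ X = ∃ λ x → ∀ v → (v ∈ X ⇔ Connected G φ₁ φ₂ x v)

IsGlued : (G : Graph) → Coloring G → Coloring G → Subset (n G) → Coloring G → Set
IsGlued G φ₁ φ₂ X φ₃ = ∀ u v → (φ₃ u ≡ φ₃ v ⇔
  ((u ∈ X × v ∈ X × φ₁ u ≡ φ₁ v) ⊎ (u ∉ X × v ∉ X × φ₂ u ≡ φ₂ v)))

-- The number of colors of a coloring depends only on its color classes, and can
-- be counted vertex by vertex: a vertex contributes 1 iff no later vertex shares
-- its class. A component X of H(φ₁,φ₂) is a union of classes of both colorings,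
-- so at every vertex one of the gluings φ₁|X ∪ φ₂|X̄ and φ₂|X ∪ φ₁|X̄ has the class
-- of φ₁ and the other the class of φ₂. Hence the two gluings together use
-- 2χ_t(G) colors, and as neither uses fewer than χ_t(G), both are optimal.
-- For (b), if v₂ lay outside the component X of v₁, then v₁ and v₂ would both be
-- singleton classes of the gluing on X; as they are joined by at most t − 1
-- edges, merging them would give an SD_t-coloring with one color fewer.

module Submission where

open import Defs
open import Data.Nat using (ℕ; _≤_; _∸_)
open import Data.Fin.Subset using (Subset; _∈_; _∉_)
open import Data.Product using (_×_)
open import Data.Sum using (_⊎_)
open import Relation.Binary.PropositionalEquality using (_≢_)
open import Function.Bundles using (_⇔_)

open import Algebra.Properties.CommutativeSemigroup using (interchange)
open import Data.Nat using (zero; suc; _+_; _*_; _<_; z≤n)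
import Data.Nat as ℕ
open import Data.Nat.Properties
open import Data.Nat.ListAction using (sum)
open import Data.Fin using (Fin)
import Data.Fin as Fin
open import Data.Fin.Properties using (any?)
open import Data.Fin.Subset using (_⊆_; _∪_; ⁅_⁆; ∣_∣)
open import Data.Fin.Subset.Properties
  using (_∈?_; x∈⁅x⁆; x∈⁅y⁆⇒x≡y; p⊆p∪q; q⊆p∪q; x∈p∪q⁻; p⊂q⇒∣p∣<∣q∣; ∣p∣≤n)
open import Data.List using (List; []; _∷_; length; map; filter; deduplicate; allFin)
open import Data.List.Properties using (filter-all; filter-accept; filter-reject)
open import Data.List.Relation.Unary.Any as Any using (Any; here; there)
import Data.List.Relation.Unary.Any.Properties as Any
open import Data.List.Relation.Unary.All as All using (All; []; _∷_)
open import Data.List.Relation.Unary.AllPairs using ([]; _∷_)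
open import Data.List.Relation.Unary.Unique.Propositional using (Unique)
open import Data.List.Relation.Unary.Unique.Propositional.Properties using (allFin⁺)
open import Data.List.Relation.Unary.Unique.DecPropositional.Properties ℕ._≟_
  using (deduplicate-!)
open import Data.List.Membership.Propositional using () renaming (_∈_ to _∈ₗ_)
open import Data.List.Membership.Propositional.Properties using (∈-allFin; deduplicate-∈⇔)
open import Data.List.Membership.DecPropositional ℕ._≟_ using () renaming (_∈?_ to _∈ₗ?_)
open import Data.Product using (Σ; ∃; _,_; proj₁; proj₂)
open import Data.Sum using (inj₁; inj₂; [_,_]′)
import Data.Sum as Sum
open import Function using (_∘_; id)
open import Function.Bundles using (mk⇔; module Equivalence)
open import Relation.Binary.Construct.Closure.ReflexiveTransitive using (Star; ε; _◅_; _◅◅_)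
open import Relation.Binary.PropositionalEquality
  using (_≡_; refl; sym; trans; cong; cong₂; subst; subst₂; module ≡-Reasoning)
open import Relation.Nullary using (Dec; yes; no; ¬_; ¬?; contradiction)
open import Relation.Nullary.Decidable using (_×-dec_; _⊎-dec_; decidable-stable; toSum)

open Equivalence using (to; from)

fresh : {P : Set} → Dec P → ℕ
fresh (yes _) = 0
fresh (no _)  = 1

fresh-mono : {P Q : Set} → (Q → P) → (p : Dec P) (q : Dec Q) → fresh p ≤ fresh q
fresh-mono _   (yes _) _       = z≤n
fresh-mono _   (no _)  (no _)  = ≤-refl
fresh-mono q⇒p (no ¬p) (yes q) = contradiction (q⇒p q) ¬p

fresh-cong : {P Q : Set} → P ⇔ Q → (p : Dec P) (q : Dec Q) → fresh p ≡ fresh q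
fresh-cong p⇔q p q = ≤-antisym (fresh-mono (from p⇔q) p q) (fresh-mono (to p⇔q) q p)

fresh-yes : {P : Set} → P → (p : Dec P) → fresh p ≡ 0
fresh-yes _  (yes _) = refl
fresh-yes pf (no ¬p) = contradiction pf ¬p

fresh-no : {P : Set} → ¬ P → (p : Dec P) → fresh p ≡ 1
fresh-no ¬p (yes pf) = contradiction pf ¬p
fresh-no _  (no _)   = refl

length-filter-≢ : ∀ y {zs} → Unique zs →
  fresh (y ∈ₗ? zs) + length zs ≡ suc (length (filter (¬? ∘ (y ℕ.≟_)) zs))
length-filter-≢ y [] = refl
length-filter-≢ y {z ∷ zs} (z∉zs ∷ unique) = byCases (y ℕ.≟ z)
  where
  open ≡-Reasoning
  P? = ¬? ∘ (y ℕ.≟_)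
  byCases : Dec (y ≡ z) →
    fresh (y ∈ₗ? z ∷ zs) + suc (length zs) ≡ suc (length (filter P? (z ∷ zs)))
  byCases (yes refl) = begin
    fresh (y ∈ₗ? y ∷ zs) + suc (length zs) ≡⟨ cong (_+ _) (fresh-yes (here refl) (y ∈ₗ? y ∷ zs)) ⟩
    suc (length zs)                        ≡⟨ cong (suc ∘ length) (filter-all P? z∉zs) ⟨
    suc (length (filter P? zs))            ≡⟨ cong (suc ∘ length) (filter-reject P? (λ y≢y → y≢y refl)) ⟨
    suc (length (filter P? (y ∷ zs)))      ∎
  byCases (no y≢z) = begin
    fresh (y ∈ₗ? z ∷ zs) + suc (length zs) ≡⟨ +-suc _ _ ⟩
    suc (fresh (y ∈ₗ? z ∷ zs) + length zs) ≡⟨ cong (λ k → suc (k + length zs)) (fresh-cong y∈z∷zs⇔y∈zs _ _) ⟩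
    suc (fresh (y ∈ₗ? zs) + length zs)     ≡⟨ cong suc (length-filter-≢ y unique) ⟩
    suc (suc (length (filter P? zs)))      ≡⟨ cong (suc ∘ length) (filter-accept P? y≢z) ⟨
    suc (length (filter P? (z ∷ zs)))      ∎
    where
    y∈z∷zs⇔y∈zs : y ∈ₗ z ∷ zs ⇔ y ∈ₗ zs
    y∈z∷zs⇔y∈zs = mk⇔ (λ { (here y≡z) → contradiction y≡z y≢z ; (there y∈zs) → y∈zs }) there

length-deduplicate-∷ : ∀ y ys →
  length (deduplicate ℕ._≟_ (y ∷ ys)) ≡ fresh (y ∈ₗ? ys) + length (deduplicate ℕ._≟_ ys)
length-deduplicate-∷ y ys = sym (begin
  fresh (y ∈ₗ? ys) + length (deduplicate ℕ._≟_ ys)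
    ≡⟨ cong (_+ _) (fresh-cong (deduplicate-∈⇔ ℕ._≟_) (y ∈ₗ? ys) (y ∈ₗ? deduplicate ℕ._≟_ ys)) ⟩
  fresh (y ∈ₗ? deduplicate ℕ._≟_ ys) + length (deduplicate ℕ._≟_ ys)
    ≡⟨ length-filter-≢ y (deduplicate-! ys) ⟩
  length (deduplicate ℕ._≟_ (y ∷ ys)) ∎)
  where open ≡-Reasoning

module _ {A : Set} where

  laterMate? : (f : A → ℕ) (x : A) (xs : List A) → Dec (Any (λ w → f w ≡ f x) xs)
  laterMate? f x = Any.any? (λ w → f w ℕ.≟ f x)

  freshAt : (A → ℕ) → A → List A → ℕ
  freshAt f x xs = fresh (laterMate? f x xs)

  classCount : (A → ℕ) → List A → ℕ
  classCount f []       = 0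
  classCount f (x ∷ xs) = freshAt f x xs + classCount f xs

  length-deduplicate-map : ∀ f xs → length (deduplicate ℕ._≟_ (map f xs)) ≡ classCount f xs
  length-deduplicate-map f []       = refl
  length-deduplicate-map f (x ∷ xs) = begin
    length (deduplicate ℕ._≟_ (map f (x ∷ xs)))        ≡⟨ length-deduplicate-∷ (f x) (map f xs) ⟩
    fresh (f x ∈ₗ? map f xs) + length (deduplicate ℕ._≟_ (map f xs))
      ≡⟨ cong₂ _+_ (fresh-cong fx∈fxs⇔ _ _) (length-deduplicate-map f xs) ⟩
    freshAt f x xs + classCount f xs                   ∎
    where
    open ≡-Reasoning
    fx∈fxs⇔ : f x ∈ₗ map f xs ⇔ Any (λ w → f w ≡ f x) xs
    fx∈fxs⇔ = mk⇔ (Any.map sym ∘ Any.map⁻) (Any.map⁺ ∘ Any.map sym)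

  SameClassAt : (A → ℕ) → (A → ℕ) → A → Set
  SameClassAt f g x = ∀ w → (f w ≡ f x ⇔ g w ≡ g x)

  freshAt-cong : ∀ {f g x} → SameClassAt f g x → ∀ xs → freshAt f x xs ≡ freshAt g x xs
  freshAt-cong same xs =
    fresh-cong (mk⇔ (Any.map (λ {w} → to (same w))) (Any.map (λ {w} → from (same w))))
               (laterMate? _ _ xs) (laterMate? _ _ xs)

  classCount-interchange : ∀ f g f′ g′ →
    (∀ x → (SameClassAt f′ f x × SameClassAt g′ g x) ⊎ (SameClassAt f′ g x × SameClassAt g′ f x)) →
    ∀ l → classCount f′ l + classCount g′ l ≡ classCount f l + classCount g l
  classCount-interchange f g f′ g′ same []       = refl
  classCount-interchange f g f′ g′ same (x ∷ xs) = begin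
    (freshAt f′ x xs + classCount f′ xs) + (freshAt g′ x xs + classCount g′ xs)
      ≡⟨ interchange +-commutativeSemigroup (freshAt f′ x xs) _ (freshAt g′ x xs) _ ⟩
    (freshAt f′ x xs + freshAt g′ x xs) + (classCount f′ xs + classCount g′ xs)
      ≡⟨ cong₂ _+_ (freshAtSum (same x)) (classCount-interchange f g f′ g′ same xs) ⟩
    (freshAt f x xs + freshAt g x xs) + (classCount f xs + classCount g xs)
      ≡⟨ interchange +-commutativeSemigroup (freshAt f x xs) _ (freshAt g x xs) _ ⟨
    (freshAt f x xs + classCount f xs) + (freshAt g x xs + classCount g xs) ∎
    where
    open ≡-Reasoning
    freshAtSum : (SameClassAt f′ f x × SameClassAt g′ g x) ⊎ (SameClassAt f′ g x × SameClassAt g′ f x) →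
      freshAt f′ x xs + freshAt g′ x xs ≡ freshAt f x xs + freshAt g x xs
    freshAtSum (inj₁ (f′~f , g′~g)) = cong₂ _+_ (freshAt-cong f′~f xs) (freshAt-cong g′~g xs)
    freshAtSum (inj₂ (f′~g , g′~f)) =
      trans (cong₂ _+_ (freshAt-cong f′~g xs) (freshAt-cong g′~f xs)) (+-comm (freshAt g x xs) (freshAt f x xs))

  freshAt-∘-≤ : ∀ (r : ℕ → ℕ) g x xs → freshAt (r ∘ g) x xs ≤ freshAt g x xs
  freshAt-∘-≤ r g x xs = fresh-mono (Any.map (cong r)) (laterMate? (r ∘ g) x xs) (laterMate? g x xs)

  classCount-∘-≤ : ∀ (r : ℕ → ℕ) g l → classCount (r ∘ g) l ≤ classCount g l
  classCount-∘-≤ r g []       = z≤n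
  classCount-∘-≤ r g (x ∷ xs) = +-mono-≤ (freshAt-∘-≤ r g x xs) (classCount-∘-≤ r g xs)

  classCount-merge-<-head : ∀ (r : ℕ → ℕ) g {x y xs} → All (x ≢_) xs →
    (∀ w → g w ≡ g x → w ≡ x) → y ∈ₗ xs → r (g y) ≡ r (g x) →
    classCount (r ∘ g) (x ∷ xs) < classCount g (x ∷ xs)
  classCount-merge-<-head r g {x} {y} {xs} x∉xs single y∈xs merged = begin-strict
    freshAt (r ∘ g) x xs + classCount (r ∘ g) xs ≡⟨ cong (_+ _) (fresh-yes mergedLater (laterMate? (r ∘ g) x xs)) ⟩
    classCount (r ∘ g) xs                        ≤⟨ classCount-∘-≤ r g xs ⟩
    classCount g xs                              <⟨ n<1+n _ ⟩
    1 + classCount g xs                          ≡⟨ cong (_+ _) (fresh-no notLater (laterMate? g x xs)) ⟨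
    freshAt g x xs + classCount g xs             ∎
    where
    open ≤-Reasoning
    mergedLater : Any (λ w → r (g w) ≡ r (g x)) xs
    mergedLater = Any.map (λ { refl → merged }) y∈xs
    notLater : ¬ Any (λ w → g w ≡ g x) xs
    notLater later = All.lookup x∉xs (Any.map (λ {w} e → sym (single w e)) later) refl

  classCount-merge-< : ∀ (r : ℕ → ℕ) g {a b} → a ≢ b → r (g a) ≡ r (g b) →
    (∀ w → g w ≡ g a → w ≡ a) → (∀ w → g w ≡ g b → w ≡ b) →
    ∀ {l} → Unique l → a ∈ₗ l → b ∈ₗ l → classCount (r ∘ g) l < classCount g l
  classCount-merge-< r g a≢b _ _ _ _ (here refl) (here refl) = contradiction refl a≢b
  classCount-merge-< r g a≢b merged singleA _ (a∉xs ∷ _) (here refl) (there b∈xs) =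
    classCount-merge-<-head r g a∉xs singleA b∈xs (sym merged)
  classCount-merge-< r g a≢b merged _ singleB (b∉xs ∷ _) (there a∈xs) (here refl) =
    classCount-merge-<-head r g b∉xs singleB a∈xs merged
  classCount-merge-< r g a≢b merged singleA singleB (_ ∷ unique) (there a∈xs) (there b∈xs) =
    +-mono-≤-< (freshAt-∘-≤ r g _ _)
               (classCount-merge-< r g a≢b merged singleA singleB unique a∈xs b∈xs)

module Reachability {m : ℕ} {R : Fin m → Fin m → Set} (R? : ∀ u v → Dec (R u v)) where

  Closed : Subset m → Set
  Closed A = ∀ {u v} → u ∈ A → R u v → v ∈ A

  Closed-star : ∀ {A} → Closed A → ∀ {u v} → u ∈ A → Star R u v → v ∈ A
  Closed-star closed u∈A ε            = u∈A
  Closed-star closed u∈A (step ◅ path) = Closed-star closed (closed u∈A step) path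

  Exit : Subset m → Set
  Exit A = ∃ λ u → ∃ λ v → u ∈ A × R u v × v ∉ A

  exit-or-closed : ∀ A → Exit A ⊎ Closed A
  exit-or-closed A with any? (λ u → any? (λ v → (u ∈? A) ×-dec R? u v ×-dec ¬? (v ∈? A)))
  ... | yes exit  = inj₁ exit
  ... | no noExit = inj₂ λ {u} {v} u∈A step →
    decidable-stable (v ∈? A) (λ v∉A → noExit (u , v , u∈A , step , v∉A))

  -- Adding the endpoint of an exit strictly grows the set, so after at most m
  -- additions the set is closed.
  saturate : ∀ x fuel A → m ≤ fuel + ∣ A ∣ → (∀ v → v ∈ A → Star R x v) →
    Σ (Subset m) λ B → A ⊆ B × Closed B × (∀ v → v ∈ B → Star R x v)
  saturate x fuel A bound reach with exit-or-closed A
  ... | inj₂ closed = A , id , closed , reach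
  ... | inj₁ (u , v , u∈A , step , v∉A) = extend fuel bound
    where
    A′ = A ∪ ⁅ v ⁆
    grows : ∣ A ∣ < ∣ A′ ∣
    grows = p⊂q⇒∣p∣<∣q∣ (p⊆p∪q ⁅ v ⁆ , v , q⊆p∪q A ⁅ v ⁆ (x∈⁅x⁆ v) , v∉A)
    reach′ : ∀ w → w ∈ A′ → Star R x w
    reach′ w w∈A′ with x∈p∪q⁻ A ⁅ v ⁆ w∈A′
    ... | inj₁ w∈A  = reach w w∈A
    ... | inj₂ w∈⁅v⁆ rewrite x∈⁅y⁆⇒x≡y v w∈⁅v⁆ = reach u u∈A ◅◅ (step ◅ ε)
    bound′ : ∀ fuel → m ≤ suc fuel + ∣ A ∣ → m ≤ fuel + ∣ A′ ∣
    bound′ fuel bound = ≤-trans bound (subst (_≤ fuel + ∣ A′ ∣) (+-suc fuel ∣ A ∣) (+-monoʳ-≤ fuel grows))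
    extend : ∀ fuel → m ≤ fuel + ∣ A ∣ →
      Σ (Subset m) λ B → A ⊆ B × Closed B × (∀ v → v ∈ B → Star R x v)
    extend zero    bound = contradiction (≤-trans grows (∣p∣≤n A′)) (≤⇒≯ bound)
    extend (suc fuel) bound with saturate x fuel A′ (bound′ fuel bound) reach′
    ... | B , A′⊆B , closed , reachB = B , A′⊆B ∘ p⊆p∪q ⁅ v ⁆ , closed , reachB

  reachableSet : ∀ x → Σ (Subset m) λ X → ∀ v → (v ∈ X ⇔ Star R x v)
  reachableSet x with saturate x m ⁅ x ⁆ (m≤m+n m _) (λ v v∈⁅x⁆ → subst (Star R x) (sym (x∈⁅y⁆⇒x≡y x v∈⁅x⁆)) ε)
  ... | X , ⁅x⁆⊆X , closed , reach = X , λ v → mk⇔ (reach v) (Closed-star closed (⁅x⁆⊆X (x∈⁅x⁆ x)))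

redirect : ℕ → ℕ → ℕ → ℕ
redirect c d x with x ℕ.≟ c
... | yes _ = d
... | no _  = x

redirect-hit : ∀ c d → redirect c d c ≡ d
redirect-hit c d with c ℕ.≟ c
... | yes _   = refl
... | no c≢c  = contradiction refl c≢c

redirect-miss : ∀ {c d x} → x ≢ c → redirect c d x ≡ x
redirect-miss {c} {d} {x} x≢c with x ℕ.≟ c
... | yes x≡c = contradiction x≡c x≢c
... | no _    = refl

redirect-≢ : ∀ {c d x} → redirect c d x ≢ d → redirect c d x ≡ x
redirect-≢ {c} {d} {x} r≢d with x ℕ.≟ c
... | yes _ = contradiction refl r≢d
... | no _  = refl

sum-map-zero : ∀ {A : Set} (f : A → ℕ) {l} → All (λ w → f w ≡ 0) l → sum (map f l) ≡ 0
sum-map-zero f []             = refl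
sum-map-zero f (fw≡0 ∷ rest) = cong₂ _+_ fw≡0 (sum-map-zero f rest)

sum-map-single : ∀ {m} (f : Fin m → ℕ) o {l} → Unique l → (∀ w → w ≢ o → f w ≡ 0) →
  sum (map f l) ≤ f o
sum-map-single f o []                        vanish = z≤n
sum-map-single f o {x ∷ xs} (x∉xs ∷ unique) vanish with x Fin.≟ o
... | yes refl = ≤-reflexive (trans (cong (f x +_) restVanishes) (+-identityʳ (f x)))
  where restVanishes = sum-map-zero f (All.map (λ x≢w → vanish _ (x≢w ∘ sym)) x∉xs)
... | no x≢o   = subst (_≤ f o) (cong (_+ sum (map f xs)) (sym (vanish x x≢o))) (sum-map-single f o unique vanish)

module _ {G : Graph} where

  degIn≤mult : (H : Subgraph G) {a b : Vertex G} → (∀ v → v ∈ vset H → v ≡ a ⊎ v ≡ b) →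
    degIn H a ≤ mult G a b
  degIn≤mult H {a} {b} inPair =
    ≤-trans (sum-map-single (emult H a) b (allFin⁺ (n G)) vanish) (emult≤ H a b)
    where
    vanish : ∀ w → w ≢ b → emult H a w ≡ 0
    vanish w w≢b with w Fin.≟ a
    ... | yes refl = n≤0⇒n≡0 (subst (emult H a a ≤_) (loopless G a) (emult≤ H a a))
    ... | no w≢a   = n≤0⇒n≡0 (≮⇒≥ λ positive →
      [ w≢a , w≢b ]′ (inPair w (proj₂ (emult-supp H a w positive))))

  strictlyDegenerate-pair : ∀ {t a b} → mult G a b ≤ t ∸ 1 →
    StrictlyDegenerateOn G t (λ v → v ≡ a ⊎ v ≡ b)
  strictlyDegenerate-pair {t} {a} {b} few H inPair (u , u∈H) = u , u∈H , degreeBound (inPair u u∈H)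
    where
    degreeBound : u ≡ a ⊎ u ≡ b → degIn H u ≤ t ∸ 1
    degreeBound (inj₁ refl) = ≤-trans (degIn≤mult H inPair) few
    degreeBound (inj₂ refl) = ≤-trans (degIn≤mult H (λ v → Sum.swap ∘ inPair v))
                                      (subst (_≤ t ∸ 1) (mult-sym G a b) few)

  isSDColoring-byClasses : ∀ {t} (ψ : Coloring G) →
    (∀ u → Σ (Vertex G → Set) λ A → StrictlyDegenerateOn G t A × (∀ v → ψ v ≡ ψ u → A v)) →
    IsSDColoring G t ψ
  isSDColoring-byClasses ψ cover c H inClass (u , u∈H) with cover u
  ... | A , sdA , classInA =
    sdA H (λ v v∈H → classInA v (trans (inClass v v∈H) (sym (inClass u u∈H)))) (u , u∈H)

  glue : Coloring G → Coloring G → Subset (n G) → Coloring G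
  glue α β X v with v ∈? X
  ... | yes _ = 2 * α v
  ... | no _  = suc (2 * β v)

  glue-isGlued : ∀ α β X → IsGlued G α β X (glue α β X)
  glue-isGlued α β X u v with u ∈? X | v ∈? X
  ... | yes u∈X | yes v∈X = mk⇔ (λ e → inj₁ (u∈X , v∈X , *-cancelˡ-≡ _ _ 2 e))
    [ cong (2 *_) ∘ proj₂ ∘ proj₂ , (λ u∉X → contradiction u∈X (proj₁ u∉X)) ]′
  ... | yes u∈X | no v∉X  = mk⇔ (λ e → contradiction e (even≢odd (α u) (β v)))
    [ (λ v∈X → contradiction (proj₁ (proj₂ v∈X)) v∉X) , (λ u∉X → contradiction u∈X (proj₁ u∉X)) ]′
  ... | no u∉X  | yes v∈X = mk⇔ (λ e → contradiction (sym e) (even≢odd (α v) (β u)))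
    [ (λ u∈X → contradiction (proj₁ u∈X) u∉X) , (λ v∉X → contradiction v∈X (proj₁ (proj₂ v∉X))) ]′
  ... | no u∉X  | no v∉X  = mk⇔ (λ e → inj₂ (u∉X , v∉X , *-cancelˡ-≡ _ _ 2 (suc-injective e)))
    [ (λ u∈X → contradiction (proj₁ u∈X) u∉X) , cong (suc ∘ (2 *_)) ∘ proj₂ ∘ proj₂ ]′

  closed-∈ : ∀ {φ X} → IsClosed G φ X → ∀ {v w} → v ∈ X → φ w ≡ φ v → w ∈ X
  closed-∈ {φ} closed {v} {w} v∈X same with closed (φ v)
  ... | inj₁ inside  = inside w same
  ... | inj₂ outside = contradiction v∈X (outside v refl)

  closed-∉ : ∀ {φ X} → IsClosed G φ X → ∀ {v w} → v ∉ X → φ w ≡ φ v → w ∉ X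
  closed-∉ {φ} closed {v} {w} v∉X same with closed (φ v)
  ... | inj₁ inside  = contradiction (inside v refl) v∉X
  ... | inj₂ outside = outside w same

  module _ {α β ψ : Coloring G} {X : Subset (n G)} (glued : IsGlued G α β X ψ) where

    glued-sameClass-∈ : IsClosed G α X → ∀ {v} → v ∈ X → SameClassAt ψ α v
    glued-sameClass-∈ closed {v} v∈X w = mk⇔
      (λ e → [ proj₂ ∘ proj₂ , (λ out → contradiction v∈X (proj₁ (proj₂ out))) ]′ (to (glued w v) e))
      (λ e → from (glued w v) (inj₁ (closed-∈ closed v∈X e , v∈X , e)))

    glued-sameClass-∉ : IsClosed G β X → ∀ {v} → v ∉ X → SameClassAt ψ β v
    glued-sameClass-∉ closed {v} v∉X w = mk⇔
      (λ e → [ (λ inside → contradiction (proj₁ (proj₂ inside)) v∉X) , proj₂ ∘ proj₂ ]′ (to (glued w v) e))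
      (λ e → from (glued w v) (inj₂ (closed-∉ closed v∉X e , v∉X , e)))

    glued-isSDColoring : ∀ {t} → IsSDColoring G t α → IsSDColoring G t β → IsSDColoring G t ψ
    glued-isSDColoring {t} sdα sdβ = isSDColoring-byClasses {t} ψ classCover
      where
      classCover : ∀ u → Σ (Vertex G → Set) λ A → StrictlyDegenerateOn G t A × (∀ v → ψ v ≡ ψ u → A v)
      classCover u with u ∈? X
      ... | yes u∈X = (λ v → α v ≡ α u) , sdα (α u) , λ v e →
        [ proj₂ ∘ proj₂ , (λ out → contradiction u∈X (proj₁ (proj₂ out))) ]′ (to (glued v u) e)
      ... | no u∉X  = (λ v → β v ≡ β u) , sdβ (β u) , λ v e →
        [ (λ inside → contradiction (proj₁ (proj₂ inside)) u∉X) , proj₂ ∘ proj₂ ]′ (to (glued v u) e)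

  InI-cong : ∀ {ψ α v} → SameClassAt ψ α v → InI G ψ v ⇔ InI G α v
  InI-cong same = mk⇔ (λ single w e → single w (from (same w) e))
                      (λ single w e → single w (to (same w) e))

  InI-glued : ∀ {α β ψ X} → IsClosed G α X → IsClosed G β X → IsGlued G α β X ψ →
    ∀ v → InI G ψ v ⇔ ((InI G α v × v ∈ X) ⊎ (InI G β v × v ∉ X))
  InI-glued {α} {β} {ψ} {X} closedα closedβ glued v with v ∈? X
  ... | yes v∈X = mk⇔ (λ single → inj₁ (to inIα single , v∈X))
    [ from inIα ∘ proj₁ , (λ out → contradiction v∈X (proj₂ out)) ]′
    where inIα = InI-cong (glued-sameClass-∈ glued closedα v∈X)
  ... | no v∉X  = mk⇔ (λ single → inj₂ (to inIβ single , v∉X))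
    [ (λ inside → contradiction (proj₂ inside) v∉X) , from inIβ ∘ proj₁ ]′
    where inIβ = InI-cong (glued-sameClass-∉ glued closedβ v∉X)

  numClasses≡classCount : ∀ φ → numClasses G φ ≡ classCount φ (allFin (n G))
  numClasses≡classCount φ = length-deduplicate-map φ (allFin (n G))

  numClasses-glued : ∀ {α β ψ ψ′ X} → IsClosed G α X → IsClosed G β X →
    IsGlued G α β X ψ → IsGlued G β α X ψ′ →
    numClasses G ψ + numClasses G ψ′ ≡ numClasses G α + numClasses G β
  numClasses-glued {α} {β} {ψ} {ψ′} {X} closedα closedβ glued glued′ = begin
    numClasses G ψ + numClasses G ψ′     ≡⟨ cong₂ _+_ (numClasses≡classCount ψ) (numClasses≡classCount ψ′) ⟩
    classCount ψ V + classCount ψ′ V     ≡⟨ classCount-interchange α β ψ ψ′ sides V ⟩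
    classCount α V + classCount β V      ≡⟨ cong₂ _+_ (numClasses≡classCount α) (numClasses≡classCount β) ⟨
    numClasses G α + numClasses G β      ∎
    where
    open ≡-Reasoning
    V = allFin (n G)
    sides : ∀ x → (SameClassAt ψ α x × SameClassAt ψ′ β x) ⊎ (SameClassAt ψ β x × SameClassAt ψ′ α x)
    sides x with x ∈? X
    ... | yes x∈X = inj₁ (glued-sameClass-∈ glued closedα x∈X , glued-sameClass-∈ glued′ closedβ x∈X)
    ... | no x∉X  = inj₂ (glued-sameClass-∉ glued closedβ x∉X , glued-sameClass-∉ glued′ closedα x∉X)

  module _ {t : ℕ} where

    optimal-minimal : ∀ {α ψ} → IsOptimal G t α → IsSDColoring G t ψ → numClasses G α ≤ numClasses G ψ
    optimal-minimal (_ , _ , minimal) sdψ = minimal _ sdψ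

    optimal-byCount : ∀ {α ψ} → IsOptimal G t α → IsSDColoring G t ψ →
      numClasses G ψ ≡ numClasses G α → IsOptimal G t ψ
    optimal-byCount {ψ = ψ} optα sdψ sameCount =
      sdψ , (ψ , sdψ , refl) , λ ρ sdρ → subst (_≤ numClasses G ρ) (sym sameCount) (optimal-minimal optα sdρ)

    glued-optimal : ∀ {α β ψ X} → IsOptimal G t α → IsOptimal G t β →
      IsClosed G α X → IsClosed G β X → IsGlued G α β X ψ → IsOptimal G t ψ
    glued-optimal {α} {β} {ψ} {X} optα optβ closedα closedβ glued =
      optimal-byCount optα sdψ (≤-antisym atMost (optimal-minimal optα sdψ))
      where
      ψ′ = glue β α X
      sdψ  = glued-isSDColoring glued {t} (proj₁ optα) (proj₁ optβ)
      sdψ′ = glued-isSDColoring (glue-isGlued β α X) {t} (proj₁ optβ) (proj₁ optα)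
      atMost : numClasses G ψ ≤ numClasses G α
      atMost = +-cancelʳ-≤ (numClasses G α) (numClasses G ψ) (numClasses G α) (begin
        numClasses G ψ + numClasses G α   ≤⟨ +-monoʳ-≤ (numClasses G ψ) (optimal-minimal optα sdψ′) ⟩
        numClasses G ψ + numClasses G ψ′  ≡⟨ numClasses-glued closedα closedβ glued (glue-isGlued β α X) ⟩
        numClasses G α + numClasses G β   ≡⟨ cong (numClasses G α +_) (≤-antisym
                                               (optimal-minimal optβ (proj₁ optα))
                                               (optimal-minimal optα (proj₁ optβ))) ⟩
        numClasses G α + numClasses G α   ∎)
        where open ≤-Reasoning

    optimal-singletons-heavy : ∀ {ψ a b} → IsOptimal G t ψ → InI G ψ a → InI G ψ b → a ≢ b →
      ¬ (mult G a b ≤ t ∸ 1)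
    optimal-singletons-heavy {ψ} {a} {b} optψ singleA singleB a≢b few =
      <⇒≱ fewerColors (optimal-minimal optψ sdμ)
      where
      r = redirect (ψ b) (ψ a)
      μ = r ∘ ψ
      merged : r (ψ a) ≡ r (ψ b)
      merged = trans (redirect-miss (a≢b ∘ singleB a)) (sym (redirect-hit (ψ b) (ψ a)))
      fewerColors : numClasses G μ < numClasses G ψ
      fewerColors = subst₂ _<_ (sym (numClasses≡classCount μ)) (sym (numClasses≡classCount ψ))
        (classCount-merge-< r ψ a≢b merged singleA singleB (allFin⁺ (n G)) (∈-allFin a) (∈-allFin b))
      mergedClass : ∀ v → μ v ≡ ψ a → v ≡ a ⊎ v ≡ b
      mergedClass v μv≡ψa = Sum.swap (Sum.map (singleB v)
        (λ ψv≢ψb → singleA v (trans (sym (redirect-miss ψv≢ψb)) μv≡ψa)) (toSum (ψ v ℕ.≟ ψ b)))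
      classCover : ∀ u → Σ (Vertex G → Set) λ A → StrictlyDegenerateOn G t A × (∀ v → μ v ≡ μ u → A v)
      classCover u with μ u ℕ.≟ ψ a
      ... | yes μu≡ψa = (λ v → v ≡ a ⊎ v ≡ b) , strictlyDegenerate-pair {t} few ,
        λ v μv≡μu → mergedClass v (trans μv≡μu μu≡ψa)
      ... | no μu≢ψa  = (λ v → ψ v ≡ ψ u) , proj₁ optψ (ψ u) ,
        λ v μv≡μu → trans (sym (redirect-≢ (μu≢ψa ∘ trans (sym μv≡μu)))) (trans μv≡μu (redirect-≢ μu≢ψa))
      sdμ : IsSDColoring G t μ
      sdμ = isSDColoring-byClasses {t} μ classCover

  bigClass? : ∀ φ u → Dec (BigClass G φ u)
  bigClass? φ u = any? λ w → ¬? (w Fin.≟ u) ×-dec (φ w ℕ.≟ φ u)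

  coEdge? : ∀ φ₁ φ₂ u v → Dec (CoEdge G φ₁ φ₂ u v)
  coEdge? φ₁ φ₂ u v =
    ((φ₁ u ℕ.≟ φ₁ v) ×-dec bigClass? φ₁ u) ⊎-dec ((φ₂ u ℕ.≟ φ₂ v) ×-dec bigClass? φ₂ u)

  component : ∀ φ₁ φ₂ x → Σ (Subset (n G)) λ X → ∀ v → (v ∈ X ⇔ Connected G φ₁ φ₂ x v)
  component φ₁ φ₂ = Reachability.reachableSet (coEdge? φ₁ φ₂)

  component-isClosed : ∀ {φ₁ φ₂ X} → IsComponent G φ₁ φ₂ X → IsClosed G φ₁ X × IsClosed G φ₂ X
  component-isClosed {φ₁} {φ₂} {X} (x , X⇔) = closedUnder φ₁ inj₁ , closedUnder φ₂ inj₂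
    where
    closedUnder : ∀ φ → (∀ {u v} → φ u ≡ φ v × BigClass G φ u → CoEdge G φ₁ φ₂ u v) → IsClosed G φ X
    closedUnder φ coEdge c with any? (λ v → (φ v ℕ.≟ c) ×-dec (v ∈? X))
    ... | no noneInside = inj₂ λ v φv≡c v∈X → noneInside (v , φv≡c , v∈X)
    ... | yes (v₀ , φv₀≡c , v₀∈X) = inj₁ classmate
      where
      classmate : ∀ v → φ v ≡ c → v ∈ X
      classmate v φv≡c with v Fin.≟ v₀
      ... | yes refl  = v₀∈X
      ... | no v≢v₀ = from (X⇔ v) (to (X⇔ v₀) v₀∈X ◅◅ (edge ◅ ε))
        where edge = coEdge (trans φv₀≡c (sym φv≡c) , v , v≢v₀ , trans φv≡c (sym φv₀≡c))

  optimal-singletons-connected : ∀ {t φ₁ φ₂ v₁ v₂} → IsOptimal G t φ₁ → IsOptimal G t φ₂ →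
    InI G φ₁ v₁ → InI G φ₂ v₂ → v₁ ≢ v₂ → mult G v₁ v₂ ≤ t ∸ 1 → Connected G φ₁ φ₂ v₁ v₂
  optimal-singletons-connected {t} {φ₁} {φ₂} {v₁} {v₂} opt₁ opt₂ single₁ single₂ v₁≢v₂ few
    with component φ₁ φ₂ v₁
  ... | X , X⇔ with v₂ ∈? X
  ...   | yes v₂∈X = to (X⇔ v₂) v₂∈X
  ...   | no v₂∉X  = contradiction few (optimal-singletons-heavy {t} optψ singleψ₁ singleψ₂ v₁≢v₂)
    where
    closed₁ = proj₁ (component-isClosed (v₁ , X⇔))
    closed₂ = proj₂ (component-isClosed (v₁ , X⇔))
    ψ = glue φ₁ φ₂ X
    glued = glue-isGlued φ₁ φ₂ X
    optψ : IsOptimal G t ψ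
    optψ = glued-optimal {t} opt₁ opt₂ closed₁ closed₂ glued
    singleψ₁ : InI G ψ v₁
    singleψ₁ = from (InI-glued closed₁ closed₂ glued v₁) (inj₁ (single₁ , from (X⇔ v₁) ε))
    singleψ₂ : InI G ψ v₂
    singleψ₂ = from (InI-glued closed₁ closed₂ glued v₂) (inj₂ (single₂ , v₂∉X))

proposition20 : (t : ℕ) → 1 ≤ t → (G : Graph) → MaxMultAtMost G t →
    (φ₁ φ₂ : Coloring G) → IsOptimal G t φ₁ → IsOptimal G t φ₂ →
    ((X : Subset (n G)) → IsComponent G φ₁ φ₂ X →
      IsClosed G φ₁ X × IsClosed G φ₂ X ×
      ((φ₃ : Coloring G) → IsGlued G φ₁ φ₂ X φ₃ →
        IsOptimal G t φ₃ ×
        (∀ v → (InI G φ₃ v ⇔ ((InI G φ₁ v × v ∈ X) ⊎ (InI G φ₂ v × v ∉ X))))))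
    ×
    ((v₁ v₂ : Vertex G) → InI G φ₁ v₁ → InI G φ₂ v₂ → v₁ ≢ v₂ →
      mult G v₁ v₂ ≤ t ∸ 1 → Connected G φ₁ φ₂ v₁ v₂)
proposition20 t _ G _ φ₁ φ₂ opt₁ opt₂ =
  (λ X comp → let (closed₁ , closed₂) = component-isClosed {G} comp in
    closed₁ , closed₂ , λ φ₃ glued →
      glued-optimal {G} {t} opt₁ opt₂ closed₁ closed₂ glued , InI-glued {G} closed₁ closed₂ glued) ,
  λ _ _ → optimal-singletons-connected {G} {t} opt₁ opt₂
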